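{- Let $\rho$ be a polarity of $\mathrm{PG}(2,q^3)$ commuting with $\alpha$, and let $\rho_{\mathcal{F}}$ be the induced polarity of the Figueroa plane $\mathcal{F}$. Let $T$ be a set of three points containing at least two points of $\mathcal{O}_1\cup\mathcal{O}_2$. Then $T$ is a self-polar triangle of $\mathrm{PG}(2,q^3)$ with respect to $\rho$ if and only if $T$ is a self-polar triangle of $\mathcal{F}$ with respect to $\rho_{\mathcal{F}}$.
   Context: Let $q>2$ be a prime power and $\alpha$ a collineation of order $3$ of $\mathrm{PG}(2,q^3)$ whose fixed points form a subplane isomorphic to $\mathrm{PG}(2,q)$. Point classes: $x\in\mathcal{O}_1$ if $x^\alpha=x$, $x\in\mathcal{O}_2$ if $x,x^\alpha,x^{\alpha^2}$ are distinct and collinear, $x\in\mathcal{O}_3$ if distinct and not collinear; line classes $\mathcal{L}_1,\mathcal{L}_2,\mathcal{L}_3$ dually. $\mu$ maps $x\in\mathcal{O}_3$ to the line $x^\alpha x^{\alpha^2}$ and $\ell\in\mathcal{L}_3$ to the point $\ell^\alpha\cap\ell^{\alpha^2}$; maps are written as exponents composed left to right. The Figueroa plane $\mathcal{F}$ has the points of $\mathrm{PG}(2,q^3)$; its lines are the lines of $\mathcal{L}_1\cup\mathcal{L}_2$ (as point sets) and, for each $\ell\in\mathcal{L}_3$, the set $\ell_{\mathcal{F}}$ of points of $\ell$ in $\mathcal{O}_1\cup\mathcal{O}_2$ together with the points $P\in\mathcal{O}_3$ with $\ell^\mu\in P^\mu$. For a polarity $\rho$ of $\mathrm{PG}(2,q^3)$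 with $\rho\alpha=\alpha\rho$, the polarity $\rho_{\mathcal{F}}$ of $\mathcal{F}$ is defined by: $\rho_{\mathcal{F}}=\rho$ on points of $\mathcal{O}_1\cup\mathcal{O}_2$ and lines of $\mathcal{L}_1\cup\mathcal{L}_2$; $x^{\rho_{\mathcal{F}}}=(x^\rho)_{\mathcal{F}}$ for $x\in\mathcal{O}_3$; $(\ell_{\mathcal{F}})^{\rho_{\mathcal{F}}}=\ell^\rho$ for $\ell\in\mathcal{L}_3$. A self-polar triangle with respect to a polarity is a set of three distinct points each of which lies on the polar lines of the other two (equivalently, each vertex has the opposite side as its polar line). -}

module Defs where

open import Level using (0ℓ)
open import Data.Nat using (ℕ; suc; _^_; _≤_)
open import Data.Nat.Primality using (Prime)
open import Data.Fin using (Fin)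
open import Data.Product using (Σ; ∃; ∃-syntax; _×_; _,_)
open import Data.Sum using (_⊎_)
open import Relation.Nullary using (¬_)
open import Relation.Binary.PropositionalEquality using (_≡_)
open import Algebra.Structures using (IsCommutativeRing)

record Field : Set₁ where
  infixl 7 _*_
  infixl 6 _+_
  infix  4 _≈_
  field
    Carrier : Set
    _≈_     : Carrier → Carrier → Set
    _+_     : Carrier → Carrier → Carrier
    _*_     : Carrier → Carrier → Carrier
    -_      : Carrier → Carrier
    0#      : Carrier
    1#      : Carrier
    isCommutativeRing : IsCommutativeRing _≈_ _+_ _*_ -_ 0# 1#
    0≉1     : ¬ (0# ≈ 1#)
    inverse : ∀ x → ¬ (x ≈ 0#) → ∃[ y ] (x * y ≈ 1#)

record HasOrder (F : Field) (n : ℕ) : Set where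
  open Field F
  field
    enum       : Fin n → Carrier
    enum-inj   : ∀ i j → enum i ≈ enum j → i ≡ j
    enum-surj  : ∀ x → ∃[ i ] (enum i ≈ x)

IsPrimePower : ℕ → Set
IsPrimePower q = ∃[ p ] ∃[ k ] (Prime p × 1 ≤ k × q ≡ p ^ k)

-- The projective plane PG(2,F): points and lines are nonzero vectors of
-- F³ up to nonzero scalars; x is incident with ℓ iff x₁ℓ₁+x₂ℓ₂+x₃ℓ₃ = 0.

module PG (F : Field) where
  open Field F

  Vec3 : Set
  Vec3 = Carrier × Carrier × Carrier

  NonZero : Vec3 → Set
  NonZero (x , y , z) = ¬ (x ≈ 0# × y ≈ 0# × z ≈ 0#)

  Point : Set
  Point = Σ Vec3 NonZero

  Line : Set
  Line = Σ Vec3 NonZero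

  _~_ : Σ Vec3 NonZero → Σ Vec3 NonZero → Set
  ((x₁ , x₂ , x₃) , _) ~ ((y₁ , y₂ , y₃) , _) =
    ∃[ c ] (¬ (c ≈ 0#) × x₁ ≈ c * y₁ × x₂ ≈ c * y₂ × x₃ ≈ c * y₃)

  _I_ : Point → Line → Set
  ((x₁ , x₂ , x₃) , _) I ((l₁ , l₂ , l₃) , _) = x₁ * l₁ + x₂ * l₂ + x₃ * l₃ ≈ 0#

  Collinear : Point → Point → Point → Set
  Collinear x y z = ∃[ ℓ ] (x I ℓ × y I ℓ × z I ℓ)

  Concurrent : Line → Line → Line → Set
  Concurrent l m n = ∃[ x ] (x I l × x I m × x I n)

  Distinct3 : Σ Vec3 NonZero → Σ Vec3 NonZero → Σ Vec3 NonZero → Set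
  Distinct3 x y z = ¬ (x ~ y) × ¬ (x ~ z) × ¬ (y ~ z)

  record Collineation : Set where
    field
      αP : Point → Point
      αL : Line → Line
      αP-cong : ∀ x y → x ~ y → αP x ~ αP y
      αL-cong : ∀ l m → l ~ m → αL l ~ αL m
      αP-inj  : ∀ x y → αP x ~ αP y → x ~ y
      αL-inj  : ∀ l m → αL l ~ αL m → l ~ m
      αP-surj : ∀ y → ∃[ x ] (αP x ~ y)
      αL-surj : ∀ m → ∃[ l ] (αL l ~ m)
      α-inc   : ∀ x l → (x I l → αP x I αL l) × (αP x I αL l → x I l)

  record Polarity : Set where
    field
      ρP : Point → Line
      ρL : Line → Point
      ρP-cong : ∀ x y → x ~ y → ρP x ~ ρP y
      ρL-cong : ∀ l m → l ~ m → ρL l ~ ρL m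
      ρ-inc   : ∀ x l → (x I l → ρL l I ρP x) × (ρL l I ρP x → x I l)
      ρ-invP  : ∀ x → ρL (ρP x) ~ x
      ρ-invL  : ∀ l → ρP (ρL l) ~ l

  SelfPolar : {L : Set} → (Point → L → Set) → (Point → L) →
              Point → Point → Point → Set
  SelfPolar J π a b c =
    Distinct3 a b c ×
    J a (π b) × J a (π c) × J b (π a) × J b (π c) × J c (π a) × J c (π b)

  AtLeastTwo : (Point → Set) → Point → Point → Point → Set
  AtLeastTwo P a b c = (P a × P b) ⊎ (P a × P c) ⊎ (P b × P c)

  module WithCollineation (α : Collineation) where
    open Collineation α

    α²P : Point → Point
    α²P x = αP (αP x)
    α²L : Line → Line
    α²L l = αL (αL l)

    Order3 : Set
    Order3 = (∀ x → αP (α²P x) ~ x) × (∀ l → αL (α²L l) ~ l) × (∃[ x ] ¬ (αP x ~ x))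

    O₁ O₂ O₃ : Point → Set
    O₁ x = αP x ~ x
    O₂ x = Distinct3 x (αP x) (α²P x) × Collinear x (αP x) (α²P x)
    O₃ x = Distinct3 x (αP x) (α²P x) × ¬ Collinear x (αP x) (α²P x)

    L₁ L₂ L₃ : Line → Set
    L₁ l = αL l ~ l
    L₂ l = Distinct3 l (αL l) (α²L l) × Concurrent l (αL l) (α²L l)
    L₃ l = Distinct3 l (αL l) (α²L l) × ¬ Concurrent l (αL l) (α²L l)

    -- ℓ^μ ∈ P^μ for ℓ ∈ L₃, P ∈ O₃: the point ℓ^α ∩ ℓ^{α²} lies on the
    -- line P^α P^{α²} (these are uniquely determined since ℓ^α ≠ ℓ^{α²}
    -- and P^α ≠ P^{α²}).
    μInc : Point → Line → Set
    μInc P l = ∃[ m ] ∃[ n ] (m I αL l × m I α²L l × αP P I n × α²P P I n × m I n)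

    -- The Figueroa plane: its points are those of PG(2,q³); its lines are
    -- in bijection with the lines of PG(2,q³), the line ℓ of PG(2,q³)
    -- representing ℓ itself if ℓ ∈ L₁ ∪ L₂ and ℓ_F if ℓ ∈ L₃.
    _I𝓕_ : Point → Line → Set
    x I𝓕 l = ((L₁ l ⊎ L₂ l) × x I l)
           ⊎ (L₃ l × (((O₁ x ⊎ O₂ x) × x I l) ⊎ (O₃ x × μInc x l)))

    -- The induced polarity ρ_F on points of F, in the above representation
    -- of lines of F:  x ↦ x^ρ (as a line of L₁∪L₂) for x ∈ O₁ ∪ O₂ and
    -- x ↦ (x^ρ)_F for x ∈ O₃; both are represented by x^ρ.
    ρ𝓕P : Polarity → Point → Line
    ρ𝓕P ρ x = Polarity.ρP ρ x

    Commutes : Polarity → Set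
    Commutes ρ = (∀ x → ρP (αP x) ~ αL (ρP x)) × (∀ l → ρL (αL l) ~ αP (ρL l))
      where open Polarity ρ

-- "the fixed points of α form a subplane isomorphic to PG(2,K)":
-- an injective map of points of PG(2,K) onto the fixed points of α, and an
-- injective map of lines of PG(2,K) onto the lines of PG(2,F) containing
-- two distinct fixed points, preserving incidence both ways.
record FixedSubplaneIso (F K : Field) (α : PG.Collineation F) : Set where
  private
    module A = PG F
    module B = PG K
  open PG.Collineation α
  field
    φP : B.Point → A.Point
    φL : B.Line → A.Line
    φP-cong : ∀ x y → x B.~ y → φP x A.~ φP y
    φL-cong : ∀ l m → l B.~ m → φL l A.~ φL m
    φP-inj  : ∀ x y → φP x A.~ φP y → x B.~ y
    φL-inj  : ∀ l m → φL l A.~ φL m → l B.~ m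
    φP-fixed : ∀ x → αP (φP x) A.~ φP x
    φP-onto  : ∀ y → αP y A.~ y → ∃[ x ] (φP x A.~ y)
    φL-sub   : ∀ l → ∃[ x ] ∃[ y ] (¬ (x A.~ y) × αP x A.~ x × αP y A.~ y × x A.I φL l × y A.I φL l)
    φL-onto  : ∀ m x y → ¬ (x A.~ y) → αP x A.~ x → αP y A.~ y → x A.I m → y A.I m →
               ∃[ l ] (φL l A.~ m)
    φ-inc    : ∀ x l → (x B.I l → φP x A.I φL l) × (φP x A.I φL l → x B.I l)

-- If x ∈ O₁ ∪ O₂ then x ∉ O₃, and since ρ commutes with α the polar line x^ρ
-- behaves under α as x does, so x^ρ ∈ L₁ ∪ L₂.  Hence, whenever one of x, y
-- lies in O₁ ∪ O₂, the Figueroa incidence of x with y^ρ falls into a clause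
-- that coincides with ordinary incidence; with two vertices in O₁ ∪ O₂ each
-- of the six incidences of a self-polar triangle involves one of them.
module Submission where

open import Defs
open import Data.Nat using (ℕ; _^_; _<_)
open import Data.Fin using (Fin)
open import Data.Fin.Properties using (any?)
import Data.Fin.Properties as Fin
open import Data.Product using (Σ; ∃; ∃-syntax; _×_; _,_; proj₁; proj₂)
open import Data.Sum using (_⊎_; inj₁; inj₂; swap)
open import Data.Empty using (⊥-elim)
open import Function using (_∘_)
open import Function.Bundles using (_⇔_; mk⇔; Equivalence)
open import Relation.Nullary using (¬_; Dec; yes; no)
open import Relation.Nullary.Decidable using (_×-dec_; ¬?; map′)
open import Relation.Binary.PropositionalEquality using (_≡_; cong)
open import Algebra.Structures using (IsCommutativeRing)
import Relation.Binary.Reasoning.Setoid as SetoidReasoning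

module FieldProperties (F : Field) where
  open Field F
  open IsCommutativeRing isCommutativeRing
  open SetoidReasoning setoid

  infix 4 _≉_
  _≉_ : Carrier → Carrier → Set
  x ≉ y = ¬ (x ≈ y)

  module _ {c : Carrier} (c≉0 : c ≉ 0#) where
    c⁻¹ : Carrier
    c⁻¹ = proj₁ (inverse c c≉0)

    c⁻¹*c≈1 : c⁻¹ * c ≈ 1#
    c⁻¹*c≈1 = trans (*-comm c⁻¹ c) (proj₂ (inverse c c≉0))

    c⁻¹≉0 : c⁻¹ ≉ 0#
    c⁻¹≉0 c⁻¹≈0 = 0≉1 (begin
      0#       ≈⟨ sym (zeroˡ c) ⟩
      0# * c   ≈⟨ *-congʳ (sym c⁻¹≈0) ⟩
      c⁻¹ * c  ≈⟨ c⁻¹*c≈1 ⟩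
      1#       ∎)

    x≈c*y⇒y≈c⁻¹*x : ∀ {x y} → x ≈ c * y → y ≈ c⁻¹ * x
    x≈c*y⇒y≈c⁻¹*x {x} {y} x≈cy = begin
      y              ≈⟨ sym (*-identityˡ y) ⟩
      1# * y         ≈⟨ *-congʳ (sym c⁻¹*c≈1) ⟩
      (c⁻¹ * c) * y  ≈⟨ *-assoc c⁻¹ c y ⟩
      c⁻¹ * (c * y)  ≈⟨ *-congˡ (sym x≈cy) ⟩
      c⁻¹ * x        ∎

    *-cancelˡ-≈0 : ∀ {x} → c * x ≈ 0# → x ≈ 0#
    *-cancelˡ-≈0 {x} cx≈0 = begin
      x          ≈⟨ x≈c*y⇒y≈c⁻¹*x (sym cx≈0) ⟩
      c⁻¹ * 0#   ≈⟨ zeroʳ c⁻¹ ⟩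
      0#         ∎

  *-≉0 : ∀ {c d} → c ≉ 0# → d ≉ 0# → c * d ≉ 0#
  *-≉0 c≉0 d≉0 cd≈0 = d≉0 (*-cancelˡ-≈0 c≉0 cd≈0)

  *-comm-middle : ∀ a c b → a * (c * b) ≈ c * (a * b)
  *-comm-middle a c b = begin
    a * (c * b)  ≈⟨ sym (*-assoc a c b) ⟩
    (a * c) * b  ≈⟨ *-congʳ (*-comm a c) ⟩
    (c * a) * b  ≈⟨ *-assoc c a b ⟩
    c * (a * b)  ∎

module ProjectiveEquality (F : Field) where
  open Field F
  open IsCommutativeRing isCommutativeRing
  open FieldProperties F
  open PG F
  open SetoidReasoning setoid

  ~-sym : ∀ {x y} → x ~ y → y ~ x
  ~-sym (c , c≉0 , e₁ , e₂ , e₃) =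
    c⁻¹ c≉0 , c⁻¹≉0 c≉0 ,
    x≈c*y⇒y≈c⁻¹*x c≉0 e₁ , x≈c*y⇒y≈c⁻¹*x c≉0 e₂ , x≈c*y⇒y≈c⁻¹*x c≉0 e₃

  ~-trans : ∀ {x y z} → x ~ y → y ~ z → x ~ z
  ~-trans (c , c≉0 , e₁ , e₂ , e₃) (d , d≉0 , f₁ , f₂ , f₃) =
    c * d , *-≉0 c≉0 d≉0 , compose e₁ f₁ , compose e₂ f₂ , compose e₃ f₃
    where
    compose : ∀ {x y z} → x ≈ c * y → y ≈ d * z → x ≈ (c * d) * z
    compose e f = trans e (trans (*-congˡ f) (sym (*-assoc c d _)))

  I-respʳ-~ : ∀ {x l m} → x I l → l ~ m → x I m
  I-respʳ-~ {(x₁ , x₂ , x₃) , _} {(l₁ , l₂ , l₃) , _} {(m₁ , m₂ , m₃) , _}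
    x∈l (c , c≉0 , e₁ , e₂ , e₃) = *-cancelˡ-≈0 c≉0 (begin
      c * (x₁ * m₁ + x₂ * m₂ + x₃ * m₃)
        ≈⟨ distribˡ c _ _ ⟩
      c * (x₁ * m₁ + x₂ * m₂) + c * (x₃ * m₃)
        ≈⟨ +-congʳ (distribˡ c _ _) ⟩
      c * (x₁ * m₁) + c * (x₂ * m₂) + c * (x₃ * m₃)
        ≈⟨ sym (+-cong (+-cong (scale e₁) (scale e₂)) (scale e₃)) ⟩
      x₁ * l₁ + x₂ * l₂ + x₃ * l₃
        ≈⟨ x∈l ⟩
      0# ∎)
    where
    scale : ∀ {xᵢ lᵢ mᵢ} → lᵢ ≈ c * mᵢ → xᵢ * lᵢ ≈ c * (xᵢ * mᵢ)
    scale {xᵢ} {lᵢ} {mᵢ} e = trans (*-congˡ e) (*-comm-middle xᵢ c mᵢ)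

module FiniteFieldDecidability (F : Field) {n : ℕ} (H : HasOrder F n) where
  open Field F
  open IsCommutativeRing isCommutativeRing
  open HasOrder H
  open PG F
  open FieldProperties F using (_≉_)

  index : Carrier → Fin n
  index x = proj₁ (enum-surj x)

  enum-index : ∀ x → enum (index x) ≈ x
  enum-index x = proj₂ (enum-surj x)

  infix 4 _≟_
  _≟_ : ∀ x y → Dec (x ≈ y)
  x ≟ y = map′ from-index to-index (index x Fin.≟ index y)
    where
    from-index : index x ≡ index y → x ≈ y
    from-index i≡j = trans (sym (enum-index x)) (trans (reflexive (cong enum i≡j)) (enum-index y))
    to-index : x ≈ y → index x ≡ index y
    to-index x≈y = enum-inj _ _ (trans (enum-index x) (trans x≈y (sym (enum-index y))))

  ∃? : {P : Carrier → Set} → (∀ {x y} → x ≈ y → P x → P y) →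
       (∀ x → Dec (P x)) → Dec (∃ P)
  ∃? resp P? = map′ (λ (i , p) → enum i , p)
                    (λ (x , p) → index x , resp (sym (enum-index x)) p)
                    (any? (P? ∘ enum))

  infix 4 _≈³_
  _≈³_ : Vec3 → Vec3 → Set
  (x₁ , x₂ , x₃) ≈³ (y₁ , y₂ , y₃) = x₁ ≈ y₁ × x₂ ≈ y₂ × x₃ ≈ y₃

  ∃³? : {P : Vec3 → Set} → (∀ {u v} → u ≈³ v → P u → P v) →
        (∀ v → Dec (P v)) → Dec (∃ P)
  ∃³? {P} resp P? =
    map′ (λ (x₁ , x₂ , x₃ , p) → (x₁ , x₂ , x₃) , p)
         (λ ((x₁ , x₂ , x₃) , p) → x₁ , x₂ , x₃ , p)
         (∃? {λ x₁ → ∃ λ x₂ → ∃ λ x₃ → P (x₁ , x₂ , x₃)}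
             (λ e (x₂ , x₃ , p) → x₂ , x₃ , resp (e , refl , refl) p) λ x₁ →
          ∃? {λ x₂ → ∃ λ x₃ → P (x₁ , x₂ , x₃)}
             (λ e (x₃ , p) → x₃ , resp (refl , e , refl) p) λ x₂ →
          ∃? {λ x₃ → P (x₁ , x₂ , x₃)}
             (λ e p → resp (refl , refl , e) p) λ x₃ →
          P? (x₁ , x₂ , x₃))

  I-resp-≈³ : ∀ {u v ℓ} {u≢0 : NonZero u} {v≢0 : NonZero v} →
              u ≈³ v → (u , u≢0) I ℓ → (v , v≢0) I ℓ
  I-resp-≈³ {ℓ = (ℓ₁ , ℓ₂ , ℓ₃) , _} (e₁ , e₂ , e₃) =
    trans (sym (+-cong (+-cong (*-congʳ e₁) (*-congʳ e₂)) (*-congʳ e₃)))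

  _~?_ : ∀ (l m : Line) → Dec (l ~ m)
  ((l₁ , l₂ , l₃) , _) ~? ((m₁ , m₂ , m₃) , _) =
    ∃? resp λ c → ¬? (c ≟ 0#) ×-dec l₁ ≟ c * m₁ ×-dec l₂ ≟ c * m₂ ×-dec l₃ ≟ c * m₃
    where
    resp : ∀ {c d} → c ≈ d →
           c ≉ 0# × l₁ ≈ c * m₁ × l₂ ≈ c * m₂ × l₃ ≈ c * m₃ →
           d ≉ 0# × l₁ ≈ d * m₁ × l₂ ≈ d * m₂ × l₃ ≈ d * m₃
    resp c≈d (c≉0 , e₁ , e₂ , e₃) =
      (c≉0 ∘ trans c≈d) , trans e₁ (*-congʳ c≈d) , trans e₂ (*-congʳ c≈d) , trans e₃ (*-congʳ c≈d)

  concurrent? : ∀ l m k → Dec (Concurrent l m k)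
  concurrent? l m k =
    map′ (λ (v , v≢0 , p) → (v , v≢0) , p) (λ ((v , v≢0) , p) → v , v≢0 , p)
         (∃³? resp common?)
    where
    Common : Vec3 → Set
    Common v = Σ (NonZero v) λ v≢0 → (v , v≢0) I l × (v , v≢0) I m × (v , v≢0) I k

    nonZero? : ∀ v → Dec (NonZero v)
    nonZero? (x₁ , x₂ , x₃) = ¬? (x₁ ≟ 0# ×-dec x₂ ≟ 0# ×-dec x₃ ≟ 0#)

    common? : ∀ v → Dec (Common v)
    common? v with nonZero? v
    ... | no v≡0 = no (v≡0 ∘ proj₁)
    ... | yes v≢0 = map′ (v≢0 ,_) proj₂
                        (incident? l ×-dec incident? m ×-dec incident? k)
      where
      incident? : ∀ ℓ → Dec ((v , v≢0) I ℓ)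
      incident? ℓ = _ ≟ 0#

    resp : ∀ {u v} → u ≈³ v → Common u → Common v
    resp {u₁ , u₂ , u₃} {v} u≈v@(e₁ , e₂ , e₃) (u≢0 , p , q , r) =
      v≢0 , move l p , move m q , move k r
      where
      v≢0 : NonZero v
      v≢0 (z₁ , z₂ , z₃) = u≢0 (trans e₁ z₁ , trans e₂ z₂ , trans e₃ z₃)
      move : ∀ ℓ → ((u₁ , u₂ , u₃) , u≢0) I ℓ → (v , v≢0) I ℓ
      move ℓ = I-resp-≈³ {ℓ = ℓ} {u≢0 = u≢0} {v≢0 = v≢0} u≈v

module SelfPolarTransfer (F : Field) where
  open PG F

  EveryPairMeets : (Point → Set) → Point → Point → Point → Set
  EveryPairMeets P a b c = (P a ⊎ P b) × (P a ⊎ P c) × (P b ⊎ P c)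

  AtLeastTwo⇒EveryPairMeets : ∀ {P a b c} → AtLeastTwo P a b c → EveryPairMeets P a b c
  AtLeastTwo⇒EveryPairMeets (inj₁ (pa , pb))          = inj₁ pa , inj₁ pa , inj₁ pb
  AtLeastTwo⇒EveryPairMeets (inj₂ (inj₁ (pa , pc)))   = inj₁ pa , inj₁ pa , inj₂ pc
  AtLeastTwo⇒EveryPairMeets (inj₂ (inj₂ (pb , pc)))   = inj₂ pb , inj₂ pc , inj₁ pb

  SelfPolar-map : ∀ {L L′ : Set} {J : Point → L → Set} {J′ : Point → L′ → Set}
                  {π : Point → L} {π′ : Point → L′} {P : Point → Set} →
                  (∀ {x y} → P x ⊎ P y → J x (π y) → J′ x (π′ y)) →
                  ∀ {a b c} → EveryPairMeets P a b c →
                  SelfPolar J π a b c → SelfPolar J′ π′ a b c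
  SelfPolar-map f (ab , ac , bc) (d , a∈b , a∈c , b∈a , b∈c , c∈a , c∈b) =
    d , f ab a∈b , f ac a∈c , f (swap ab) b∈a , f bc b∈c , f (swap ac) c∈a , f (swap bc) c∈b

  SelfPolar-cong : ∀ {L L′ : Set} {J : Point → L → Set} {J′ : Point → L′ → Set}
                   {π : Point → L} {π′ : Point → L′} {P : Point → Set} →
                   (∀ {x y} → P x ⊎ P y → J x (π y) ⇔ J′ x (π′ y)) →
                   ∀ {a b c} → AtLeastTwo P a b c →
                   SelfPolar J π a b c ⇔ SelfPolar J′ π′ a b c
  SelfPolar-cong {J = J} {J′} {π} {π′} {P} J⇔J′ two = mk⇔
    (SelfPolar-map {J = J} {J′} {π} {π′} (Equivalence.to ∘ J⇔J′) meets)
    (SelfPolar-map {J = J′} {J} {π′} {π} (Equivalence.from ∘ J⇔J′) meets)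
    where meets = AtLeastTwo⇒EveryPairMeets {P} two

module OrderThreeCollineation (F : Field) {n : ℕ} (H : HasOrder F n)
  (α : PG.Collineation F) (order3 : PG.WithCollineation.Order3 F α) where
  open PG F
  open WithCollineation α
  open Collineation α
  open ProjectiveEquality F
  open FiniteFieldDecidability F H

  O₁₂ : Point → Set
  O₁₂ x = O₁ x ⊎ O₂ x

  O₁₂⇒¬O₃ : ∀ {x} → O₁₂ x → ¬ O₃ x
  O₁₂⇒¬O₃ {x} (inj₁ αx~x)        ((x≁αx , _) , _) = x≁αx (~-sym {αP x} {x} αx~x)
  O₁₂⇒¬O₃     (inj₂ (_ , collinear)) (_ , ¬collinear) = ¬collinear collinear

  ¬L₁⇒orbit-distinct : ∀ {l} → ¬ L₁ l → Distinct3 l (αL l) (α²L l)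
  ¬L₁⇒orbit-distinct {l} αl≁l =
    (αl≁l ∘ ~-sym {l} {αL l}) ,
    (λ l~α²l → αl≁l (~-trans {αL l} {αL (α²L l)} {l} (αL-cong _ _ l~α²l) (proj₁ (proj₂ order3) l))) ,
    (λ αl~α²l → αl≁l (~-sym {l} {αL l} (αL-inj _ _ αl~α²l)))

  line-trichotomy : ∀ l → (L₁ l ⊎ L₂ l) ⊎ L₃ l
  line-trichotomy l with αL l ~? l
  ... | yes αl~l = inj₁ (inj₁ αl~l)
  ... | no αl≁l with concurrent? l (αL l) (α²L l)
  ...   | yes concurrent = inj₁ (inj₂ (¬L₁⇒orbit-distinct αl≁l , concurrent))
  ...   | no ¬concurrent = inj₂ (¬L₁⇒orbit-distinct αl≁l , ¬concurrent)

  I⇒I𝓕 : ∀ {x l} → O₁₂ x ⊎ ¬ L₃ l → x I l → x I𝓕 l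
  I⇒I𝓕 {l = l} hyp x∈l with line-trichotomy l | hyp
  ... | inj₁ l₁₂ | _        = inj₁ (l₁₂ , x∈l)
  ... | inj₂ l₃  | inj₁ x₁₂ = inj₂ (l₃ , inj₁ (x₁₂ , x∈l))
  ... | inj₂ l₃  | inj₂ ¬l₃ = ⊥-elim (¬l₃ l₃)

  I𝓕⇒I : ∀ {x l} → O₁₂ x ⊎ ¬ L₃ l → x I𝓕 l → x I l
  I𝓕⇒I _          (inj₁ (_ , x∈l))             = x∈l
  I𝓕⇒I _          (inj₂ (_ , inj₁ (_ , x∈l)))  = x∈l
  I𝓕⇒I (inj₁ x₁₂) (inj₂ (_ , inj₂ (x₃ , _)))   = ⊥-elim (O₁₂⇒¬O₃ x₁₂ x₃)
  I𝓕⇒I (inj₂ ¬l₃) (inj₂ (l₃ , inj₂ _))         = ⊥-elim (¬l₃ l₃)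

  I⇔I𝓕 : ∀ {x l} → O₁₂ x ⊎ ¬ L₃ l → x I l ⇔ x I𝓕 l
  I⇔I𝓕 hyp = mk⇔ (I⇒I𝓕 hyp) (I𝓕⇒I hyp)

  module CommutingPolarity (ρ : Polarity) (commutes : Commutes ρ) where
    open Polarity ρ

    ρα~αρ : ∀ x → ρP (αP x) ~ αL (ρP x)
    ρα~αρ = proj₁ commutes

    ρα²~α²ρ : ∀ x → ρP (α²P x) ~ α²L (ρP x)
    ρα²~α²ρ x = ~-trans {ρP (α²P x)} {αL (ρP (αP x))} {α²L (ρP x)}
                  (ρα~αρ (αP x)) (αL-cong _ _ (ρα~αρ x))

    O₁₂⇒polar-¬L₃ : ∀ {y} → O₁₂ y → ¬ L₃ (ρP y)
    O₁₂⇒polar-¬L₃ {y} (inj₁ αy~y) ((ρy≁αρy , _) , _) =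
      ρy≁αρy (~-trans {ρP y} {ρP (αP y)} {αL (ρP y)}
                 (~-sym {ρP (αP y)} {ρP y} (ρP-cong _ _ αy~y)) (ρα~αρ y))
    O₁₂⇒polar-¬L₃ {y} (inj₂ (_ , ℓ , y∈ℓ , αy∈ℓ , α²y∈ℓ)) (_ , ¬concurrent) =
      ¬concurrent (ρL ℓ ,
        pole∈polar y∈ℓ ,
        I-respʳ-~ {ρL ℓ} {ρP (αP y)} {αL (ρP y)} (pole∈polar αy∈ℓ) (ρα~αρ y) ,
        I-respʳ-~ {ρL ℓ} {ρP (α²P y)} {α²L (ρP y)} (pole∈polar α²y∈ℓ) (ρα²~α²ρ y))
      where
      pole∈polar : ∀ {x} → x I ℓ → ρL ℓ I ρP x
      pole∈polar {x} = proj₁ (ρ-inc x ℓ)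

    I-polar⇔I𝓕-polar : ∀ {x y} → O₁₂ x ⊎ O₁₂ y → x I ρP y ⇔ x I𝓕 ρ𝓕P ρ y
    I-polar⇔I𝓕-polar (inj₁ x₁₂) = I⇔I𝓕 (inj₁ x₁₂)
    I-polar⇔I𝓕-polar (inj₂ y₁₂) = I⇔I𝓕 (inj₂ (O₁₂⇒polar-¬L₃ y₁₂))

lemma8 : (q : ℕ) → IsPrimePower q → 2 < q →
    (F : Field) → HasOrder F (q ^ 3) →
    (α : PG.Collineation F) →
    PG.WithCollineation.Order3 F α →
    (∃[ K ] (HasOrder K q × FixedSubplaneIso F K α)) →
    (ρ : PG.Polarity F) → PG.WithCollineation.Commutes F α ρ →
    (a b c : PG.Point F) →
    PG.Distinct3 F a b c →
    PG.AtLeastTwo F (λ x → PG.WithCollineation.O₁ F α x ⊎ PG.WithCollineation.O₂ F α x) a b c →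
    PG.SelfPolar F (PG._I_ F) (PG.Polarity.ρP ρ) a b c
    ⇔ PG.SelfPolar F (PG.WithCollineation._I𝓕_ F α) (PG.WithCollineation.ρ𝓕P F α ρ) a b c
lemma8 q _ _ F H α order3 _ ρ commutes a b c _ two =
  SelfPolar-cong {J = _I_} {_I𝓕_} {ρP} {ρ𝓕P ρ} I-polar⇔I𝓕-polar two
  where
  open PG F
  open PG.Polarity ρ
  open PG.WithCollineation F α
  open SelfPolarTransfer F
  open OrderThreeCollineation F H α order3
  open CommutingPolarity ρ commutes
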